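{- Let $\mu$ and $\nu$ be partitions of $n$ that differ by a sequence of $(i,j)$-transformations. Then $\mathcal{S}_\mu=\mathcal{S}_\nu$.
   Context: A partition is an infinite weakly decreasing sequence $\mu_1\ge\mu_2\ge\cdots$ of nonnegative integers with finitely many nonzero terms, identified with its Ferrers board (box $(i,j)$ in row $i$ from the top, column $j$ from the left). For a box $(i,j)$ of $\mu$, if replacing the subboard $\{(x,y)\in\mu:x\ge i,\ y\ge j\}$ by its conjugate (transpose, anchored at $(i,j)$) yields a partition, this is the $(i,j)$-transform of $\mu$. Row $i$ ($i\ge1$) is salient if there exists $j>i$ with $i+\mu_i\ge j+\mu_j$. $\mathcal{S}_\mu$ is the multiset $\{i+\mu_i:\text{row } i \text{ is salient in }\mu\}$. -}

module Defs where

open import Data.Nat using (ℕ; zero; suc; _+_; _≤_; _<_; _≤?_; _<?_; z≤n; s≤s)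
open import Data.Nat.Properties using (≤-trans; m≤m+n; ≤-refl; n≤1+n; <-≤-trans; ≤-<-trans; m≤n+m; _≟_)
open import Data.List using (List; []; _∷_; length; filter; upTo)
open import Data.Nat.ListAction using (sum)
open import Data.List.Relation.Unary.All using (All)
open import Data.List.Relation.Unary.Linked using (Linked)
open import Data.Product using (_×_; _,_; ∃; Σ; ∃₂; proj₁; proj₂)
open import Data.Sum using (_⊎_; inj₁; inj₂)
open import Relation.Nullary using (¬_; Dec; yes; no)
open import Relation.Nullary.Decidable using (_×-dec_)
open import Relation.Unary using (Decidable)
open import Relation.Binary.PropositionalEquality using (_≡_; refl)
open import Relation.Binary.Construct.Closure.ReflexiveTransitive using (Star)

-- Partitions: weakly decreasing finite lists of positive integers
-- (the infinite sequence is the list padded with zeros).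

record Partition : Set where
  constructor mkPartition
  field
    parts      : List ℕ
    decreasing : Linked (λ a b → b ≤ a) parts
    positive   : All (λ a → 0 < a) parts
open Partition public

nth : List ℕ → ℕ → ℕ
nth []       _       = 0
nth (x ∷ xs) zero    = x
nth (x ∷ xs) (suc k) = nth xs k

-- row μ i = μ_i for i ≥ 1 (rows are 1-based; row 0 is a dummy 0)
row : Partition → ℕ → ℕ
row μ zero    = 0
row μ (suc k) = nth (parts μ) k

IsPartitionOf : ℕ → Partition → Set
IsPartitionOf n μ = sum (parts μ) ≡ n

-- box (x , y) (row x, column y, both 1-based) lies in the Ferrers board
InBoard : Partition → ℕ → ℕ → Set
InBoard μ x y = 1 ≤ x × 1 ≤ y × y ≤ row μ x

-- ν is the (i,j)-transform of μ: (i,j) is a box of μ and the board of ν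
-- equals (board of μ minus the subboard {x ≥ i, y ≥ j}) together with the
-- conjugate of that subboard anchored at (i,j).

Transform : ℕ → ℕ → Partition → Partition → Set
Transform i j μ ν =
  InBoard μ i j ×
  (∀ x y → (InBoard ν x y →
              (InBoard μ x y × ¬ (i ≤ x × j ≤ y))
              ⊎ (i ≤ x × j ≤ y × InBoard μ (i + (y ∸' j)) (j + (x ∸' i))))
         × ((InBoard μ x y × ¬ (i ≤ x × j ≤ y))
              ⊎ (i ≤ x × j ≤ y × InBoard μ (i + (y ∸' j)) (j + (x ∸' i)))
            → InBoard ν x y))
  where
  open import Data.Nat using () renaming (_∸_ to _∸'_)

TransformStep : Partition → Partition → Set
TransformStep μ ν = ∃₂ λ i j → Transform i j μ ν

DifferByTransforms : Partition → Partition → Set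
DifferByTransforms = Star TransformStep

Salient : Partition → ℕ → Set
Salient μ i = 1 ≤ i × ∃ λ j → i < j × j + row μ j ≤ i + row μ i

anyBelow : (P : ℕ → Set) → Decidable P → ∀ n → Dec (∃ λ k → k < n × P k)
anyBelow P P? zero = no λ { (_ , () , _) }
anyBelow P P? (suc n) with P? n
... | yes p = yes (n , ≤-refl , p)
... | no ¬p with anyBelow P P? n
...   | yes (k , k<n , pk) = yes (k , ≤-trans k<n (n≤1+n n) , pk)
...   | no ¬q = no λ { (k , s≤s k≤n , pk) → helper k k≤n pk }
  where
  open import Data.Nat.Properties using (m≤n⇒m<n∨m≡n)
  helper : ∀ k → k ≤ n → P k → _
  helper k k≤n pk with m≤n⇒m<n∨m≡n k≤n
  ... | inj₁ k<n = ¬q (k , k<n , pk)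
  ... | inj₂ refl = ¬p pk

salient? : ∀ μ i → Dec (Salient μ i)
salient? μ i with 1 ≤? i | anyBelow Q Q? (suc (i + row μ i))
  where
  Q : ℕ → Set
  Q j = i < j × j + row μ j ≤ i + row μ i
  Q? : Decidable Q
  Q? j = (i <? j) ×-dec (j + row μ j ≤? i + row μ i)
... | no ¬1 | _ = no λ s → ¬1 (proj₁ s)
... | yes 1≤i | yes (j , _ , q) = yes (1≤i , j , q)
... | yes 1≤i | no ¬q = no λ { (_ , j , i<j , le) →
        ¬q (j , s≤s (≤-trans (m≤m+n j (row μ j)) le) , i<j , le) }

-- multiplicity of the value v in S_μ = {i + μ_i : row i salient}
-- (a salient row i with i + μ_i = v satisfies i ≤ v, so i ranges over 0..v)
multS : Partition → ℕ → ℕ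
multS μ v = length (filter (λ i → salient? μ i ×-dec (i + row μ i ≟ v)) (upTo (suc v)))

SameS : Partition → Partition → Set
SameS μ ν = ∀ v → multS μ v ≡ multS ν v

module Submission where

-- Write ℓ(x) = x + μ_x (lastDiag) for the antidiagonal x + y = ℓ(x)
-- carrying the last box of row x.
-- Since μ is weakly decreasing, ℓ(x+1) ≤ ℓ(x) + 1 for x ≥ 1, and ℓ(x) ≥ x;
-- by a discrete intermediate value argument a row x is salient with
-- ℓ(x) = v exactly when ℓ(x) = v and some later row l also has ℓ(l) = v.
-- Hence the multiplicity of v in S_μ is E_μ(v) - 1, where E_μ(v) is the
-- number of rows x ≥ 1 with ℓ(x) = v (rowsEndingOn).
--
-- Next let D_μ(s) (diagSize) be the number of boxes of μ on the
-- antidiagonal x + y = s.  Comparing the rows that meet antidiagonals v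
-- and v + 1 gives E_μ(v) + D_μ(v + 1) = D_μ(v) + 1 for v ≥ 1, so E_μ is determined by D_μ.
-- Finally an (i,j)-transformation maps antidiagonals to themselves: on the
-- antidiagonal s it fixes the rows outside [i, s - j] and reverses the
-- order of the rows inside.  So D_μ, hence E_μ, hence S_μ, is invariant.

open import Defs
open import Data.Nat using (ℕ; zero; suc; _+_; _∸_; _≤_; _<_; z≤n; s≤s; z<s; s<s; s≤s⁻¹; _≤?_; _<?_)
open import Data.Nat.Properties
open import Data.Nat.Tactic.RingSolver using (solve-∀)
open import Data.List using (length; filter; applyUpTo)
open import Data.List.Relation.Unary.Linked using (Linked; []; [-]; _∷_)
open import Data.Product using (_×_; _,_; ∃; proj₁; proj₂)
open import Data.Product.Function.NonDependent.Propositional using (_×-⇔_)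
open import Data.Sum using (_⊎_; inj₁; inj₂)
open import Data.Empty using (⊥-elim)
open import Function using (_∘_; id; _⇔_; mk⇔; Equivalence)
open import Function.Properties.Equivalence using () renaming (refl to ⇔-refl; sym to ⇔-sym; trans to ⇔-trans)
open import Relation.Nullary using (¬_; Dec; yes; no)
open import Relation.Nullary.Decidable using (_×-dec_; _⊎-dec_)
open import Relation.Unary using (Decidable)
open import Relation.Unary.Properties using (_∪?_)
open import Relation.Binary.PropositionalEquality
open import Relation.Binary.Construct.Closure.ReflexiveTransitive using (fold)

open Equivalence using (to; from)

private
  variable
    A B : Set
    P Q : ℕ → Set

𝟙 : Dec A → ℕ
𝟙 (yes _) = 1
𝟙 (no _) = 0

𝟙-cong : (a? : Dec A) (b? : Dec B) → A ⇔ B → 𝟙 a? ≡ 𝟙 b?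
𝟙-cong (yes _) (yes _) _ = refl
𝟙-cong (no _) (no _) _ = refl
𝟙-cong (yes a) (no ¬b) A⇔B = ⊥-elim (¬b (to A⇔B a))
𝟙-cong (no ¬a) (yes b) A⇔B = ⊥-elim (¬a (from A⇔B b))

𝟙-yes : (a? : Dec A) → A → 𝟙 a? ≡ 1
𝟙-yes (yes _) _ = refl
𝟙-yes (no ¬a) a = ⊥-elim (¬a a)

𝟙-no : (a? : Dec A) → ¬ A → 𝟙 a? ≡ 0
𝟙-no (yes a) ¬a = ⊥-elim (¬a a)
𝟙-no (no _) _ = refl

𝟙-⊎ : (a? : Dec A) (b? : Dec B) → (A → ¬ B) → 𝟙 a? + 𝟙 b? ≡ 𝟙 (a? ⊎-dec b?)
𝟙-⊎ (yes a) (yes b) disjoint = ⊥-elim (disjoint a b)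
𝟙-⊎ (yes _) (no _) _ = refl
𝟙-⊎ (no _) (yes _) _ = refl
𝟙-⊎ (no _) (no _) _ = refl

count : Decidable P → (ℕ → ℕ) → ℕ → ℕ
count P? f zero = 0
count P? f (suc n) = 𝟙 (P? (f 0)) + count P? (f ∘ suc) n

length-filter-applyUpTo : (P? : Decidable P) (f : ℕ → ℕ) (n : ℕ) →
  length (filter P? (applyUpTo f n)) ≡ count P? f n
length-filter-applyUpTo P? f zero = refl
length-filter-applyUpTo P? f (suc n) with P? (f 0)
... | yes _ = cong suc (length-filter-applyUpTo P? (f ∘ suc) n)
... | no _ = length-filter-applyUpTo P? (f ∘ suc) n

count-cong : (P? : Decidable P) (Q? : Decidable Q) (f g : ℕ → ℕ) (n : ℕ) →
  (∀ k → k < n → P (f k) ⇔ Q (g k)) → count P? f n ≡ count Q? g n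
count-cong P? Q? f g zero _ = refl
count-cong P? Q? f g (suc n) same =
  cong₂ _+_ (𝟙-cong (P? (f 0)) (Q? (g 0)) (same 0 z<s))
            (count-cong P? Q? (f ∘ suc) (g ∘ suc) n (λ k k<n → same (suc k) (s<s k<n)))

count-snoc : (P? : Decidable P) (f : ℕ → ℕ) (n : ℕ) → count P? f (suc n) ≡ count P? f n + 𝟙 (P? (f n))
count-snoc P? f zero = +-comm (𝟙 (P? (f 0))) 0
count-snoc P? f (suc n) =
  trans (cong (𝟙 (P? (f 0)) +_) (count-snoc P? (f ∘ suc) n)) (sym (+-assoc (𝟙 (P? (f 0))) _ _))

count-reverse : (P? : Decidable P) (Q? : Decidable Q) (f g : ℕ → ℕ) (n : ℕ) →
  (∀ k → k < n → P (f k) ⇔ Q (g (n ∸ suc k))) → count P? f n ≡ count Q? g n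
count-reverse P? Q? f g zero _ = refl
count-reverse P? Q? f g (suc n) same = begin
  𝟙 (P? (f 0)) + count P? (f ∘ suc) n
    ≡⟨ cong₂ _+_ (𝟙-cong (P? (f 0)) (Q? (g n)) (same 0 z<s))
                 (count-reverse P? Q? (f ∘ suc) g n (λ k k<n → same (suc k) (s<s k<n))) ⟩
  𝟙 (Q? (g n)) + count Q? g n
    ≡⟨ +-comm (𝟙 (Q? (g n))) (count Q? g n) ⟩
  count Q? g n + 𝟙 (Q? (g n))
    ≡⟨ count-snoc Q? g n ⟨
  count Q? g (suc n) ∎
  where open ≡-Reasoning

count-+ : (P? : Decidable P) (f : ℕ → ℕ) (m n : ℕ) →
  count P? f (m + n) ≡ count P? f m + count P? (λ k → f (m + k)) n
count-+ P? f zero n = refl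
count-+ P? f (suc m) n =
  trans (cong (𝟙 (P? (f 0)) +_) (count-+ P? (f ∘ suc) m n)) (sym (+-assoc (𝟙 (P? (f 0))) _ _))

count-+-+ : (P? : Decidable P) (f : ℕ → ℕ) (a b c : ℕ) → count P? f (a + (b + c)) ≡
  count P? f a + (count P? (λ k → f (a + k)) b + count P? (λ k → f (a + (b + k))) c)
count-+-+ P? f a b c = trans (count-+ P? f a (b + c)) (cong (count P? f a +_) (count-+ P? (λ k → f (a + k)) b c))

count-none : (P? : Decidable P) (f : ℕ → ℕ) (n : ℕ) → (∀ k → k < n → ¬ P (f k)) → count P? f n ≡ 0
count-none P? f zero _ = refl
count-none P? f (suc n) none =
  cong₂ _+_ (𝟙-no (P? (f 0)) (none 0 z<s)) (count-none P? (f ∘ suc) n (λ k k<n → none (suc k) (s<s k<n)))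

count-∪ : (P? : Decidable P) (Q? : Decidable Q) (f : ℕ → ℕ) (n : ℕ) →
  (∀ k → k < n → P (f k) → ¬ Q (f k)) →
  count P? f n + count Q? f n ≡ count (P? ∪? Q?) f n
count-∪ P? Q? f zero _ = refl
count-∪ P? Q? f (suc n) disjoint = begin
  (p + ps) + (q + qs) ≡⟨ interchange p ps q qs ⟩
  (p + q) + (ps + qs) ≡⟨ cong₂ _+_ (𝟙-⊎ (P? (f 0)) (Q? (f 0)) (disjoint 0 z<s))
                                   (count-∪ P? Q? (f ∘ suc) n (λ k k<n → disjoint (suc k) (s<s k<n))) ⟩
  𝟙 ((P? ∪? Q?) (f 0)) + count (P? ∪? Q?) (f ∘ suc) n ∎
  where
  open ≡-Reasoning
  p q ps qs : ℕ
  p = 𝟙 (P? (f 0))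
  q = 𝟙 (Q? (f 0))
  ps = count P? (f ∘ suc) n
  qs = count Q? (f ∘ suc) n
  interchange : ∀ a b c d → (a + b) + (c + d) ≡ (a + c) + (b + d)
  interchange = solve-∀

count-pos⇔ : (P? : Decidable P) (f : ℕ → ℕ) (n : ℕ) → (0 < count P? f n) ⇔ (∃ λ k → k < n × P (f k))
count-pos⇔ {P} P? f n = mk⇔ (witness f n) (count-positive f n)
  where
  witness : ∀ f n → 0 < count P? f n → ∃ λ k → k < n × P (f k)
  witness f (suc n) pos with P? (f 0)
  ... | yes p = 0 , z<s , p
  ... | no _ with witness (f ∘ suc) n pos
  ...   | k , k<n , p = suc k , s<s k<n , p
  count-positive : ∀ f n → (∃ λ k → k < n × P (f k)) → 0 < count P? f n
  count-positive f (suc n) (zero , _ , p) rewrite 𝟙-yes (P? (f 0)) p = z<s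
  count-positive f (suc n) (suc k , s<s k<n , p) =
    ≤-trans (count-positive (f ∘ suc) n (k , k<n , p)) (m≤n+m _ (𝟙 (P? (f 0))))

𝟙-+-∸1 : (a? : Dec A) (b? : Dec B) (c : ℕ) → A ⇔ (B × 0 < c) → 𝟙 a? + (c ∸ 1) ≡ (𝟙 b? + c) ∸ 1
𝟙-+-∸1 (yes a) (yes _) zero A⇔B with () ← proj₂ (to A⇔B a)
𝟙-+-∸1 (yes _) (yes _) (suc c) _ = refl
𝟙-+-∸1 (yes a) (no ¬b) c A⇔B = ⊥-elim (¬b (proj₁ (to A⇔B a)))
𝟙-+-∸1 (no _) (yes _) zero _ = refl
𝟙-+-∸1 (no ¬a) (yes b) (suc c) A⇔B = ⊥-elim (¬a (from A⇔B (b , z<s)))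
𝟙-+-∸1 (no _) (no _) c _ = refl

count-allButLast : (P? : Decidable P) (Q? : Decidable Q) (f : ℕ → ℕ) (n : ℕ) →
  (∀ k → k < n → P (f k) ⇔ (Q (f k) × ∃ λ l → k < l × l < n × Q (f l))) →
  count P? f n ≡ count Q? f n ∸ 1
count-allButLast P? Q? f zero _ = refl
count-allButLast {P} {Q} P? Q? f (suc n) spec =
  trans (cong (𝟙 (P? (f 0)) +_) (count-allButLast P? Q? (f ∘ suc) n spec-tail))
        (𝟙-+-∸1 (P? (f 0)) (Q? (f 0)) (count Q? (f ∘ suc) n) spec-head)
  where
  later-shift : ∀ m → (∃ λ l → m < l × l < suc n × Q (f l)) ⇔ (∃ λ l → m ≤ l × l < n × Q (f (suc l)))
  later-shift m = mk⇔ (λ { (suc l , s<s m≤l , s<s l<n , q) → l , m≤l , l<n , q })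
                      (λ { (l , m≤l , l<n , q) → suc l , s<s m≤l , s<s l<n , q })
  spec-tail : ∀ k → k < n → P (f (suc k)) ⇔ (Q (f (suc k)) × ∃ λ l → k < l × l < n × Q (f (suc l)))
  spec-tail k k<n = ⇔-trans (spec (suc k) (s<s k<n)) (⇔-refl ×-⇔ later-shift (suc k))
  spec-head : P (f 0) ⇔ (Q (f 0) × 0 < count Q? (f ∘ suc) n)
  spec-head = ⇔-trans (spec 0 z<s)
    (⇔-refl ×-⇔ ⇔-trans (later-shift 0)
      (⇔-trans (mk⇔ (λ { (l , _ , l<n , q) → l , l<n , q }) (λ { (l , l<n , q) → l , z≤n , l<n , q }))
               (⇔-sym (count-pos⇔ Q? (f ∘ suc) n))))

discrete-ivt : (f : ℕ → ℕ) {v : ℕ} (a n : ℕ) → (∀ x → a ≤ x → f (suc x) ≤ suc (f x)) →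
  f a ≤ v → v ≤ f (a + n) → ∃ λ m → a ≤ m × f m ≡ v
discrete-ivt f a zero _ fa≤v v≤f[a+0] =
  a , ≤-refl , ≤-antisym fa≤v (subst (λ t → _ ≤ f t) (+-identityʳ a) v≤f[a+0])
discrete-ivt f {v} a (suc n) step fa≤v v≤f[a+1+n] with f a ≟ v
... | yes fa≡v = a , ≤-refl , fa≡v
... | no fa≢v with discrete-ivt f (suc a) n (λ x a<x → step x (<⇒≤ a<x))
                     (≤-trans (step a ≤-refl) (≤∧≢⇒< fa≤v fa≢v))
                     (subst (λ t → v ≤ f t) (+-suc a n) v≤f[a+1+n])
...   | m , a<m , fm≡v = m , <⇒≤ a<m , fm≡v

lastDiag : Partition → ℕ → ℕ
lastDiag μ x = x + row μ x

nth-antitone : ∀ {xs} → Linked (λ a b → b ≤ a) xs → ∀ k → nth xs (suc k) ≤ nth xs k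
nth-antitone [] k = z≤n
nth-antitone [-] k = z≤n
nth-antitone (a≥b ∷ _) zero = a≥b
nth-antitone (_ ∷ rest) (suc k) = nth-antitone rest k

-- Rows weakly decrease, so lastDiag grows by at most one per row.
lastDiag-step : ∀ μ x → 1 ≤ x → lastDiag μ (suc x) ≤ suc (lastDiag μ x)
lastDiag-step μ (suc k) _ = s≤s (+-monoʳ-≤ (suc k) (nth-antitone (decreasing μ) k))

EndsOn : Partition → ℕ → ℕ → Set
EndsOn μ v x = 1 ≤ x × lastDiag μ x ≡ v

endsOn? : ∀ μ v → Decidable (EndsOn μ v)
endsOn? μ v x = (1 ≤? x) ×-dec (lastDiag μ x ≟ v)

-- The number of rows ending on antidiagonal v (all of them have x ≤ v).
rowsEndingOn : Partition → ℕ → ℕ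
rowsEndingOn μ v = count (endsOn? μ v) id (suc v)

-- A row ending on v is salient iff a later row also ends on v: a later row
-- j with lastDiag j ≤ v can be pushed forward to one with lastDiag = v.
salient⇔notLast : ∀ μ v x →
  (Salient μ x × lastDiag μ x ≡ v) ⇔ (EndsOn μ v x × ∃ λ l → x < l × l < suc v × EndsOn μ v l)
salient⇔notLast μ v x = mk⇔ notLast salient
  where
  notLast : Salient μ x × lastDiag μ x ≡ v → EndsOn μ v x × ∃ λ l → x < l × l < suc v × EndsOn μ v l
  notLast ((1≤x , j , x<j , ℓj≤ℓx) , ℓx≡v)
    with discrete-ivt (lastDiag μ) j v (λ y j≤y → lastDiag-step μ y (≤-trans 1≤x (≤-trans (<⇒≤ x<j) j≤y)))
           (subst (_ ≤_) ℓx≡v ℓj≤ℓx) (≤-trans (m≤n+m v j) (m≤m+n (j + v) _))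
  ... | m , j≤m , ℓm≡v =
    (1≤x , ℓx≡v) , m , <-≤-trans x<j j≤m , s≤s (subst (m ≤_) ℓm≡v (m≤m+n m (row μ m))) ,
    (≤-trans 1≤x (<⇒≤ (<-≤-trans x<j j≤m)) , ℓm≡v)
  salient : EndsOn μ v x × ∃ (λ l → x < l × l < suc v × EndsOn μ v l) → Salient μ x × lastDiag μ x ≡ v
  salient ((1≤x , ℓx≡v) , l , x<l , _ , (_ , ℓl≡v)) = (1≤x , l , x<l , ≤-reflexive (trans ℓl≡v (sym ℓx≡v))) , ℓx≡v

multS≡rowsEndingOn∸1 : ∀ μ v → multS μ v ≡ rowsEndingOn μ v ∸ 1
multS≡rowsEndingOn∸1 μ v =
  trans (length-filter-applyUpTo salientOn? id (suc v))
        (count-allButLast salientOn? (endsOn? μ v) id (suc v) (λ x _ → salient⇔notLast μ v x))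
  where
  salientOn? : Decidable (λ x → Salient μ x × x + row μ x ≡ v)
  salientOn? x = salient? μ x ×-dec (x + row μ x ≟ v)

OnDiag : Partition → ℕ → ℕ → Set
OnDiag μ s x = InBoard μ x (s ∸ x)

onDiag? : ∀ μ s → Decidable (OnDiag μ s)
onDiag? μ s x = (1 ≤? x) ×-dec ((1 ≤? (s ∸ x)) ×-dec ((s ∸ x) ≤? row μ x))

-- The number of boxes of μ on antidiagonal s (they all lie in rows x < s).
diagSize : Partition → ℕ → ℕ
diagSize μ s = count (onDiag? μ s) id s

onDiag⇔ : ∀ μ s x → OnDiag μ s x ⇔ (1 ≤ x × x < s × s ≤ lastDiag μ x)
onDiag⇔ μ s x = mk⇔ bounds box
  where
  bounds : OnDiag μ s x → 1 ≤ x × x < s × s ≤ lastDiag μ x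
  bounds (1≤x , 0<s∸x , s∸x≤μx) = 1≤x , x<s , s≤ℓx
    where
    x<s : x < s
    x<s = m∸n≢0⇒n<m (n>0⇒n≢0 0<s∸x)
    s≤ℓx : s ≤ lastDiag μ x
    s≤ℓx = subst (_≤ lastDiag μ x) (m+[n∸m]≡n (<⇒≤ x<s)) (+-monoʳ-≤ x s∸x≤μx)
  box : 1 ≤ x × x < s × s ≤ lastDiag μ x → OnDiag μ s x
  box (1≤x , x<s , s≤ℓx) = 1≤x , m<n⇒0<n∸m x<s , m≤n+o⇒m∸n≤o s x s≤ℓx

onDiag-at : ∀ μ {s x y} → x + y ≡ s → OnDiag μ s x ⇔ InBoard μ x y
onDiag-at μ {x = x} {y} refl rewrite m+n∸m≡n x y = ⇔-refl

endsOn-or-meetsNext⇔ : ∀ μ v x → 1 ≤ v → x ≤ v →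
  (EndsOn μ v x ⊎ OnDiag μ (suc v) x) ⇔ (OnDiag μ v x ⊎ x ≡ v)
endsOn-or-meetsNext⇔ μ v x 1≤v x≤v = mk⇔ forward backward
  where
  forward : EndsOn μ v x ⊎ OnDiag μ (suc v) x → OnDiag μ v x ⊎ x ≡ v
  forward (inj₁ (1≤x , ℓx≡v)) with m≤n⇒m<n∨m≡n x≤v
  ... | inj₁ x<v = inj₁ (from (onDiag⇔ μ v x) (1≤x , x<v , ≤-reflexive (sym ℓx≡v)))
  ... | inj₂ x≡v = inj₂ x≡v
  forward (inj₂ on) with to (onDiag⇔ μ (suc v) x) on | m≤n⇒m<n∨m≡n x≤v
  ... | 1≤x , _ , v<ℓx | inj₁ x<v = inj₁ (from (onDiag⇔ μ v x) (1≤x , x<v , <⇒≤ v<ℓx))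
  ... | _ | inj₂ x≡v = inj₂ x≡v
  backward : OnDiag μ v x ⊎ x ≡ v → EndsOn μ v x ⊎ OnDiag μ (suc v) x
  backward (inj₁ on) with to (onDiag⇔ μ v x) on | lastDiag μ x ≟ v
  ... | 1≤x , _ , _ | yes ℓx≡v = inj₁ (1≤x , ℓx≡v)
  ... | 1≤x , x<v , v≤ℓx | no ℓx≢v =
    inj₂ (from (onDiag⇔ μ (suc v) x) (1≤x , m<n⇒m<1+n x<v , ≤∧≢⇒< v≤ℓx (ℓx≢v ∘ sym)))
  backward (inj₂ refl) with 0 <? row μ x
  ... | yes 0<μx = inj₂ (from (onDiag⇔ μ (suc x) x)
                         (1≤v , n<1+n x , subst (_≤ lastDiag μ x) (+-comm x 1) (+-monoʳ-≤ x 0<μx)))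
  ... | no 0≮μx = inj₁ (1≤v , trans (cong (x +_) (n≤0⇒n≡0 (≮⇒≥ 0≮μx))) (+-identityʳ x))

rowsEndingOn-recursion : ∀ μ v → 1 ≤ v → rowsEndingOn μ v + diagSize μ (suc v) ≡ diagSize μ v + 1
rowsEndingOn-recursion μ v 1≤v = begin
  count (endsOn? μ v) id (suc v) + count (onDiag? μ (suc v)) id (suc v)
    ≡⟨ count-∪ (endsOn? μ v) (onDiag? μ (suc v)) id (suc v) endsOn-notNext ⟩
  count (endsOn? μ v ∪? onDiag? μ (suc v)) id (suc v)
    ≡⟨ count-cong (endsOn? μ v ∪? onDiag? μ (suc v)) (onDiag? μ v ∪? (_≟ v)) id id (suc v)
         (λ x x<1+v → endsOn-or-meetsNext⇔ μ v x 1≤v (s≤s⁻¹ x<1+v)) ⟩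
  count (onDiag? μ v ∪? (_≟ v)) id (suc v)
    ≡⟨ count-∪ (onDiag? μ v) (_≟ v) id (suc v) onDiag-notLast ⟨
  count (onDiag? μ v) id (suc v) + count (_≟ v) id (suc v)
    ≡⟨ cong₂ _+_ diag-extended only-v ⟩
  diagSize μ v + 1 ∎
  where
  open ≡-Reasoning
  endsOn-notNext : ∀ x → x < suc v → EndsOn μ v x → ¬ OnDiag μ (suc v) x
  endsOn-notNext x _ (_ , ℓx≡v) on = <-irrefl (sym ℓx≡v) (proj₂ (proj₂ (to (onDiag⇔ μ (suc v) x) on)))
  onDiag-notLast : ∀ x → x < suc v → OnDiag μ v x → ¬ x ≡ v
  onDiag-notLast x _ on x≡v = <-irrefl x≡v (proj₁ (proj₂ (to (onDiag⇔ μ v x) on)))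
  diag-extended : count (onDiag? μ v) id (suc v) ≡ diagSize μ v
  diag-extended = begin
    count (onDiag? μ v) id (suc v)             ≡⟨ count-snoc (onDiag? μ v) id v ⟩
    diagSize μ v + 𝟙 (onDiag? μ v v)
      ≡⟨ cong (diagSize μ v +_) (𝟙-no (onDiag? μ v v) (λ on → onDiag-notLast v (n<1+n v) on refl)) ⟩
    diagSize μ v + 0                           ≡⟨ +-identityʳ (diagSize μ v) ⟩
    diagSize μ v ∎
  only-v : count (_≟ v) id (suc v) ≡ 1
  only-v = begin
    count (_≟ v) id (suc v)                    ≡⟨ count-snoc (_≟ v) id v ⟩
    count (_≟ v) id v + 𝟙 (v ≟ v)
      ≡⟨ cong₂ _+_ (count-none (_≟ v) id v (λ k k<v k≡v → <-irrefl k≡v k<v)) (𝟙-yes (v ≟ v) refl) ⟩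
    0 + 1 ∎

rowsEndingOn-determined : ∀ μ ν → (∀ s → diagSize μ s ≡ diagSize ν s) →
  ∀ v → rowsEndingOn μ v ≡ rowsEndingOn ν v
rowsEndingOn-determined μ ν _ zero = trans (no-row μ) (sym (no-row ν))
  where
  no-row : ∀ π → rowsEndingOn π 0 ≡ 0
  no-row π = count-none (endsOn? π 0) id 1 (λ { zero _ (() , _) })
rowsEndingOn-determined μ ν sameD (suc w) = +-cancelʳ-≡ (diagSize μ (suc v)) _ _ (begin
  rowsEndingOn μ v + diagSize μ (suc v)  ≡⟨ rowsEndingOn-recursion μ v z<s ⟩
  diagSize μ v + 1                       ≡⟨ cong (_+ 1) (sameD v) ⟩
  diagSize ν v + 1                       ≡⟨ rowsEndingOn-recursion ν v z<s ⟨
  rowsEndingOn ν v + diagSize ν (suc v)  ≡⟨ cong (rowsEndingOn ν v +_) (sameD (suc v)) ⟨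
  rowsEndingOn ν v + diagSize μ (suc v)  ∎)
  where
  open ≡-Reasoning
  v : ℕ
  v = suc w

column-bound : ∀ {x y s} → 0 < y → y ≤ s ∸ x → x + y ≤ s
column-bound {x} {y} {s} 0<y y≤s∸x = subst (_≤ s) (+-comm y x) (m≤o∸n⇒m+n≤o y x≤s y≤s∸x)
  where
  x≤s : x ≤ s
  x≤s = <⇒≤ (m∸n≢0⇒n<m (n>0⇒n≢0 (<-≤-trans 0<y y≤s∸x)))

module _ {i j μ ν} (tr : Transform i j μ ν) where

  transform-outside : ∀ x y → ¬ (i ≤ x × j ≤ y) → InBoard ν x y ⇔ InBoard μ x y
  transform-outside x y outside = mk⇔ keep (λ box → proj₂ (proj₂ tr x y) (inj₁ (box , outside)))
    where
    keep : InBoard ν x y → InBoard μ x y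
    keep box with proj₁ (proj₂ tr x y) box
    ... | inj₁ (box′ , _) = box′
    ... | inj₂ (i≤x , j≤y , _) = ⊥-elim (outside (i≤x , j≤y))

  transform-inside : ∀ a b → InBoard ν (i + a) (j + b) ⇔ InBoard μ (i + b) (j + a)
  transform-inside a b =
    subst₂ (λ p q → InBoard ν (i + a) (j + b) ⇔ InBoard μ (i + p) (j + q))
           (m+n∸m≡n j b) (m+n∸m≡n i a) (mk⇔ reflect unreflect)
    where
    reflect : InBoard ν (i + a) (j + b) → InBoard μ (i + (j + b ∸ j)) (j + (i + a ∸ i))
    reflect box with proj₁ (proj₂ tr (i + a) (j + b)) box
    ... | inj₁ (_ , outside) = ⊥-elim (outside (m≤m+n i a , m≤m+n j b))
    ... | inj₂ (_ , _ , box′) = box′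
    unreflect : InBoard μ (i + (j + b ∸ j)) (j + (i + a ∸ i)) → InBoard ν (i + a) (j + b)
    unreflect box′ = proj₂ (proj₂ tr (i + a) (j + b)) (inj₂ (m≤m+n i a , m≤m+n j b , box′))

onDiag-reflected : ∀ {i j μ ν} → Transform i j μ ν → ∀ {s} k c → i + j + (k + c) ≡ s →
  OnDiag ν s (i + k) ⇔ OnDiag μ s (i + c)
onDiag-reflected {i} {j} {μ} {ν} tr {s} k c s≡ =
  ⇔-trans (onDiag-at ν row-k) (⇔-trans (transform-inside tr k c) (⇔-sym (onDiag-at μ row-c)))
  where
  regroup : ∀ i j k c → (i + k) + (j + c) ≡ i + j + (k + c)
  regroup = solve-∀
  row-k : (i + k) + (j + c) ≡ s
  row-k = trans (regroup i j k c) s≡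
  row-c : (i + c) + (j + k) ≡ s
  row-c = trans (regroup i j c k) (trans (cong (i + j +_) (+-comm c k)) s≡)

-- On an antidiagonal s = i + j + L meeting the subboard, the rows x < i and
-- x > i + L keep their box while the rows i, …, i + L are reversed.
diagSize-preserved-through : ∀ {i j′ μ ν} → Transform i (suc j′) μ ν → ∀ L →
  diagSize ν (i + suc j′ + L) ≡ diagSize μ (i + suc j′ + L)
diagSize-preserved-through {i} {j′} {μ} {ν} tr L = begin
  count (onDiag? ν s) id s                    ≡⟨ cong (count (onDiag? ν s) id) s≡blocks ⟩
  count (onDiag? ν s) id (i + (suc L + j′))   ≡⟨ count-+-+ (onDiag? ν s) id i (suc L) j′ ⟩
  count (onDiag? ν s) id i + (count (onDiag? ν s) (i +_) (suc L) + count (onDiag? ν s) beyond j′)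
    ≡⟨ cong₂ _+_ before (cong₂ _+_ reversed after) ⟩
  count (onDiag? μ s) id i + (count (onDiag? μ s) (i +_) (suc L) + count (onDiag? μ s) beyond j′)
    ≡⟨ count-+-+ (onDiag? μ s) id i (suc L) j′ ⟨
  count (onDiag? μ s) id (i + (suc L + j′))   ≡⟨ cong (count (onDiag? μ s) id) s≡blocks ⟨
  count (onDiag? μ s) id s                    ∎
  where
  open ≡-Reasoning
  s : ℕ
  s = i + suc j′ + L
  s≡blocks : s ≡ i + (suc L + j′)
  s≡blocks = regroup i j′ L
    where
    regroup : ∀ i j′ L → i + suc j′ + L ≡ i + (suc L + j′)
    regroup = solve-∀
  beyond : ℕ → ℕ
  beyond k = i + (suc L + k)
  before : count (onDiag? ν s) id i ≡ count (onDiag? μ s) id i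
  before = count-cong (onDiag? ν s) (onDiag? μ s) id id i λ x x<i →
    transform-outside tr x (s ∸ x) λ (i≤x , _) → <⇒≱ x<i i≤x
  after : count (onDiag? ν s) beyond j′ ≡ count (onDiag? μ s) beyond j′
  after = count-cong (onDiag? ν s) (onDiag? μ s) beyond beyond j′ λ k _ →
    transform-outside tr (beyond k) (s ∸ beyond k) λ (_ , j≤s∸x) → n≮n j′ (≤-trans j≤s∸x (column≤j′ k))
    where
    last-column : s ∸ (i + suc L) ≡ j′
    last-column = trans (cong (_∸ (i + suc L)) (trans s≡blocks (sym (+-assoc i (suc L) j′))))
                        (m+n∸m≡n (i + suc L) j′)
    column≤j′ : ∀ k → s ∸ beyond k ≤ j′
    column≤j′ k = ≤-trans (∸-monoʳ-≤ s (+-monoʳ-≤ i (m≤m+n (suc L) k))) (≤-reflexive last-column)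
  reversed : count (onDiag? ν s) (i +_) (suc L) ≡ count (onDiag? μ s) (i +_) (suc L)
  reversed = count-reverse (onDiag? ν s) (onDiag? μ s) (i +_) (i +_) (suc L) λ k k<1+L →
    onDiag-reflected tr k (L ∸ k) (cong (i + suc j′ +_) (m+[n∸m]≡n (s≤s⁻¹ k<1+L)))

-- A transformation preserves the number of boxes on every antidiagonal s:
-- for s < i + j the antidiagonal misses the subboard, otherwise see above.
diagSize-preserved : ∀ {i j μ ν} → Transform i j μ ν → ∀ s → diagSize ν s ≡ diagSize μ s
diagSize-preserved {j = zero} ((_ , () , _) , _) _
diagSize-preserved {i} {suc j′} {μ} {ν} tr s with i + suc j′ ≤? s
... | no corner-beyond =
  count-cong (onDiag? ν s) (onDiag? μ s) id id s (λ x _ → transform-outside tr x (s ∸ x)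
    λ (i≤x , j≤s∸x) → corner-beyond (≤-trans (+-monoˡ-≤ (suc j′) i≤x) (column-bound z<s j≤s∸x)))
... | yes corner-within =
  subst (λ t → diagSize ν t ≡ diagSize μ t) (m+[n∸m]≡n corner-within)
        (diagSize-preserved-through tr (s ∸ (i + suc j′)))

transform-preserves-S : ∀ {μ ν} → TransformStep μ ν → SameS μ ν
transform-preserves-S {μ} {ν} (_ , _ , tr) v = begin
  multS μ v              ≡⟨ multS≡rowsEndingOn∸1 μ v ⟩
  rowsEndingOn μ v ∸ 1   ≡⟨ cong (_∸ 1) (rowsEndingOn-determined μ ν (λ s → sym (diagSize-preserved tr s)) v) ⟩
  rowsEndingOn ν v ∸ 1   ≡⟨ multS≡rowsEndingOn∸1 ν v ⟨
  multS ν v              ∎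
  where open ≡-Reasoning

-- Lemma 14: partitions related by a sequence of (i,j)-transformations have the
-- same salient multiset.
lemma14 : (n : ℕ) (μ ν : Partition) → IsPartitionOf n μ → IsPartitionOf n ν →
          DifferByTransforms μ ν → SameS μ ν
lemma14 _ _ _ _ _ = fold SameS (λ step rest v → trans (transform-preserves-S step v) (rest v)) (λ _ → refl)
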